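{- For any star graph $K_{1,n}$ on $n+1$ vertices with $n\ge 4$, we have $\gamma_t(M(K_{1,n}+\overline{K_1}))=n$.
   Context: All graphs are finite and simple. $K_{1,n}$ is the star: one central vertex adjacent to $n$ other vertices. $\overline{K_1}$ is the graph with a single vertex. The join $G+H$ of graphs $G,H$ (on disjoint vertex sets) has vertex set $V(G)\cup V(H)$ and edge set $E(G)\cup E(H)\cup\{vw : v\in V(G), w\in V(H)\}$. For a graph $H$ with no isolated vertices, a total dominating set of $H$ is a set $S\subseteq V(H)$ such that every vertex of $H$ has at least one neighbor in $S$; $\gamma_t(H)$ is the minimum cardinality of a total dominating set. The middle graph $M(G)$ of a graph $G$ has vertex set $V(G)\cup E(G)$ (disjoint union), and two of its vertices $x,y$ are adjacent exactly when either $x,y\in E(G)$ are edges of $G$ sharing a common endpoint, or $x\in V(G)$, $y\in E(G)$ and $x$ is an endpoint of $y$ (no two elements of $V(G)$ are adjacent in $M(G)$). -}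

module Defs where

open import Data.Nat using (ℕ; zero; suc; _≤_)
open import Data.Fin using (Fin; zero; suc)
open import Data.Unit using (⊤; tt)
open import Data.Empty using (⊥)
open import Data.Sum using (_⊎_; inj₁; inj₂)
open import Data.Product using (_×_; _,_; proj₁; proj₂; Σ; ∃; ∃-syntax)
open import Data.List using (List; length)
open import Data.List.Membership.Propositional using (_∈_)
open import Data.List.Relation.Unary.Unique.Propositional using (Unique)
open import Relation.Binary.PropositionalEquality using (_≡_)
open import Relation.Nullary using (¬_)

-- A graph given by its vertex set, its edge set, and the two endpoints of
-- every edge.  (All concrete graphs below are finite and simple.)
record Graph : Set₁ where
  field
    V    : Set
    E    : Set
    ends : E → V × V

open Graph public

IsEnd : (G : Graph) → V G → E G → Set
IsEnd G v e = (proj₁ (ends G e) ≡ v) ⊎ (proj₂ (ends G e) ≡ v)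

Adj : (G : Graph) → V G → V G → Set
Adj G u v = ∃[ e ] (ends G e ≡ (u , v) ⊎ ends G e ≡ (v , u))

-- Star K_{1,n}: vertex 0 is the centre, vertices 1..n the leaves;
-- edge i joins the centre to leaf (suc i).
Star : ℕ → Graph
Star n = record { V = Fin (suc n) ; E = Fin n ; ends = λ i → (zero , suc i) }

K1bar : Graph
K1bar = record { V = ⊤ ; E = ⊥ ; ends = λ () }

join-ends : (G H : Graph) → (E G ⊎ E H) ⊎ (V G × V H) → (V G ⊎ V H) × (V G ⊎ V H)
join-ends G H (inj₁ (inj₁ e)) = inj₁ (proj₁ (ends G e)) , inj₁ (proj₂ (ends G e))
join-ends G H (inj₁ (inj₂ e)) = inj₂ (proj₁ (ends H e)) , inj₂ (proj₂ (ends H e))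
join-ends G H (inj₂ (v , w))  = inj₁ v , inj₂ w

_+ᴳ_ : Graph → Graph → Graph
G +ᴳ H = record
  { V    = V G ⊎ V H
  ; E    = (E G ⊎ E H) ⊎ (V G × V H)
  ; ends = join-ends G H
  }

-- Middle graph M(G): vertex set V(G) ⊎ E(G), given directly by its adjacency.
MVertex : Graph → Set
MVertex G = V G ⊎ E G

MAdj : (G : Graph) → MVertex G → MVertex G → Set
MAdj G (inj₁ v) (inj₁ w) = ⊥
MAdj G (inj₁ v) (inj₂ e) = IsEnd G v e
MAdj G (inj₂ e) (inj₁ v) = IsEnd G v e
MAdj G (inj₂ e) (inj₂ f) = ¬ (e ≡ f) × ∃[ v ] (IsEnd G v e × IsEnd G v f)

-- Total domination for a graph given by vertex type X and adjacency R.
-- Finite sets are duplicate-free lists.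
IsTotalDominating : {X : Set} → (X → X → Set) → List X → Set
IsTotalDominating {X} R S = (x : X) → ∃[ s ] (s ∈ S × R x s)

TotalDominationNumber : {X : Set} → (X → X → Set) → ℕ → Set
TotalDominationNumber {X} R k =
  (∃[ S ] (Unique S × IsTotalDominating R S × length S ≡ k))
  × ((S : List X) → Unique S → IsTotalDominating R S → k ≤ length S)

γt-Middle≡ : Graph → ℕ → Set
γt-Middle≡ G k = TotalDominationNumber (MAdj G) k

-- In M(K_{1,n} + K̄₁) a leaf ℓᵢ of the star has exactly two neighbours: the
-- spoke from the centre to ℓᵢ and the edge from ℓᵢ to the added vertex a.
-- These neighbourhoods are pairwise disjoint, so a total dominating set needs
-- a separate vertex for every leaf and γ_t ≥ n.  Conversely, taking the edges
-- ℓ₁a and ℓ₂a together with the spokes to ℓ₃, …, ℓₙ is total dominating: the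
-- two edges at a dominate each other, a and every edge at a, and the n − 2 ≥ 2
-- chosen spokes dominate each other, the centre and every spoke.
module Submission where

open import Defs
open import Data.Nat using (ℕ; suc; _+_; _≤_; s≤s)
open import Data.Fin using (Fin; zero; suc)
open import Data.Fin.Properties using (injective⇒≤; suc-injective)
open import Data.Unit using (tt)
open import Data.Empty using (⊥; ⊥-elim)
open import Data.Sum using (_⊎_; inj₁; inj₂)
open import Data.Sum.Properties using (inj₁-injective)
open import Data.Product using (_,_; proj₁; proj₂; ∃-syntax)
open import Data.List using (List; length; tabulate)
open import Data.List.Properties using (length-tabulate)
open import Data.List.Membership.Propositional using (_∈_)
open import Data.List.Membership.Propositional.Properties using (∈-tabulate⁺)
open import Data.List.Membership.Setoid.Properties using (index-injective)
open import Data.List.Relation.Unary.Unique.Propositional.Properties using (tabulate⁺)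
open import Function.Definitions using (Injective)
open import Relation.Binary.PropositionalEquality using (_≡_; _≢_; refl; sym; subst; setoid)

private variable
  n : ℕ
  X : Set

injection⇒≤length : {xs : List X} (f : Fin n → X) →
  Injective _≡_ _≡_ f → (∀ i → f i ∈ xs) → n ≤ length xs
injection⇒≤length {X = X} f f-injective f∈xs =
  injective⇒≤ λ eq → f-injective (index-injective (setoid X) (f∈xs _) (f∈xs _) eq)

DisjointNeighbourhoods : (X → X → Set) → (Fin n → X) → Set
DisjointNeighbourhoods R v = ∀ {i j s} → R (v i) s → R (v j) s → i ≡ j

neighbourChoice-injective : {R : X → X → Set} {v σ : Fin n → X} →
  DisjointNeighbourhoods R v → (∀ i → R (v i) (σ i)) → Injective _≡_ _≡_ σ
neighbourChoice-injective {R = R} {v} disjoint σ-adjacent {i} {j} eq =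
  disjoint (σ-adjacent i) (subst (R (v j)) (sym eq) (σ-adjacent j))

disjointNeighbourhoods⇒≤length : {R : X → X → Set} {v : Fin n → X} →
  DisjointNeighbourhoods R v → (S : List X) → IsTotalDominating R S → n ≤ length S
disjointNeighbourhoods⇒≤length {R = R} {v} disjoint S dominating =
  injection⇒≤length (λ i → proj₁ (dominating (v i)))
    (neighbourChoice-injective {R = R} {v} disjoint (λ i → proj₂ (proj₂ (dominating (v i)))))
    (λ i → proj₁ (proj₂ (dominating (v i))))

tabulate-totalDominating : {R : X → X → Set} (σ : Fin n → X) →
  (∀ x → ∃[ i ] R x (σ i)) → IsTotalDominating R (tabulate σ)
tabulate-totalDominating σ covers x with covers x
... | i , adjacent = σ i , ∈-tabulate⁺ i , adjacent

totalDominationNumber-≡ : {R : X → X → Set} {v : Fin n → X} (σ : Fin n → X) →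
  DisjointNeighbourhoods R v → (∀ i → R (v i) (σ i)) → (∀ x → ∃[ i ] R x (σ i)) →
  TotalDominationNumber R n
totalDominationNumber-≡ {R = R} {v} σ disjoint σ-adjacent covers =
  ( tabulate σ
  , tabulate⁺ (neighbourChoice-injective {R = R} {v} disjoint σ-adjacent)
  , tabulate-totalDominating σ covers
  , length-tabulate σ )
  , λ S _ → disjointNeighbourhoods⇒≤length {R = R} {v} disjoint S

commonNeighbour⇒≡⊎Adj : (G : Graph) {v w : V G} (s : MVertex G) →
  MAdj G (inj₁ v) s → MAdj G (inj₁ w) s → v ≡ w ⊎ Adj G v w
commonNeighbour⇒≡⊎Adj G (inj₁ _) () _
commonNeighbour⇒≡⊎Adj G (inj₂ e) (inj₁ refl) (inj₁ refl) = inj₁ refl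
commonNeighbour⇒≡⊎Adj G (inj₂ e) (inj₁ refl) (inj₂ refl) = inj₂ (e , inj₁ refl)
commonNeighbour⇒≡⊎Adj G (inj₂ e) (inj₂ refl) (inj₁ refl) = inj₂ (e , inj₂ refl)
commonNeighbour⇒≡⊎Adj G (inj₂ e) (inj₂ refl) (inj₂ refl) = inj₁ refl

StarPlusVertex : ℕ → Graph
StarPlusVertex n = Star n +ᴳ K1bar

pattern centre      = inj₁ (inj₁ zero)
pattern leaf i      = inj₁ (inj₁ (suc i))
pattern apex        = inj₁ (inj₂ tt)
pattern spoke i     = inj₂ (inj₁ (inj₁ i))
pattern apexEdge v  = inj₂ (inj₂ (v , tt))

leaves-nonadjacent : {i j : Fin n} →
  Adj (StarPlusVertex n) (inj₁ (suc i)) (inj₁ (suc j)) → ⊥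
leaves-nonadjacent (inj₁ (inj₁ _) , inj₁ ())
leaves-nonadjacent (inj₁ (inj₁ _) , inj₂ ())
leaves-nonadjacent (inj₂ _ , inj₁ ())
leaves-nonadjacent (inj₂ _ , inj₂ ())

leaf-neighbourhoods-disjoint : DisjointNeighbourhoods (MAdj (StarPlusVertex n)) (λ i → leaf i)
leaf-neighbourhoods-disjoint {n} {s = s} adjᵢ adjⱼ
  with commonNeighbour⇒≡⊎Adj (StarPlusVertex n) s adjᵢ adjⱼ
... | inj₁ eq       = suc-injective (inj₁-injective eq)
... | inj₂ adjacent = ⊥-elim (leaves-nonadjacent adjacent)

spokes-adjacent : {i j : Fin n} → i ≢ j → MAdj (StarPlusVertex n) (spoke i) (spoke j)
spokes-adjacent i≢j = (λ { refl → i≢j refl }) , inj₁ zero , inj₁ refl , inj₁ refl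

apexEdges-adjacent : {v w : Fin (suc n)} → v ≢ w →
  MAdj (StarPlusVertex n) (apexEdge v) (apexEdge w)
apexEdges-adjacent v≢w = (λ { refl → v≢w refl }) , inj₂ tt , inj₂ refl , inj₂ refl

leafNeighbour : Fin (suc (suc n)) → MVertex (StarPlusVertex (suc (suc n)))
leafNeighbour zero          = apexEdge (suc zero)
leafNeighbour (suc zero)    = apexEdge (suc (suc zero))
leafNeighbour (suc (suc i)) = spoke (suc (suc i))

leafNeighbour-adjacent : (i : Fin (suc (suc n))) →
  MAdj (StarPlusVertex (suc (suc n))) (leaf i) (leafNeighbour i)
leafNeighbour-adjacent zero          = inj₁ refl
leafNeighbour-adjacent (suc zero)    = inj₁ refl
leafNeighbour-adjacent (suc (suc i)) = inj₂ refl

leafNeighbour-covers : (x : MVertex (StarPlusVertex (4 + n))) →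
  ∃[ i ] MAdj (StarPlusVertex (4 + n)) x (leafNeighbour i)
leafNeighbour-covers centre                      = suc (suc zero) , inj₁ refl
leafNeighbour-covers (leaf i)                    = i , leafNeighbour-adjacent i
leafNeighbour-covers apex                        = zero , inj₂ refl
leafNeighbour-covers (spoke (suc (suc zero)))    = suc (suc (suc zero)) , spokes-adjacent (λ ())
leafNeighbour-covers (spoke zero)                = suc (suc zero) , spokes-adjacent (λ ())
leafNeighbour-covers (spoke (suc zero))          = suc (suc zero) , spokes-adjacent (λ ())
leafNeighbour-covers (spoke (suc (suc (suc i)))) = suc (suc zero) , spokes-adjacent (λ ())
leafNeighbour-covers (inj₂ (inj₁ (inj₂ ())))
leafNeighbour-covers (apexEdge (suc zero))       = suc zero , apexEdges-adjacent (λ ())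
leafNeighbour-covers (apexEdge zero)             = zero , apexEdges-adjacent (λ ())
leafNeighbour-covers (apexEdge (suc (suc v)))    = zero , apexEdges-adjacent (λ ())

proposition4p14 : (n : ℕ) → 4 ≤ n → γt-Middle≡ (Star n +ᴳ K1bar) n
proposition4p14 (suc (suc (suc (suc m)))) (s≤s (s≤s (s≤s (s≤s _)))) =
  totalDominationNumber-≡ leafNeighbour
    leaf-neighbourhoods-disjoint leafNeighbour-adjacent leafNeighbour-covers
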